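{- Let $\lambda$ be a partition and let $M$ be a $\lambda$-injectively decorated map such that $|\mathcal V_\circ(M)|-\mathrm{cc}(M)=0$. Then $M$ is orientable, and consequently $\vartheta(M)=0$ for every statistic of non-orientability $\vartheta$.
   Context: Maps: a connected map is a connected graph embedded in a compact surface (orientable or not) with simply connected faces, up to homeomorphism; a map is an unordered collection of connected maps, orientable iff each component is. Bipartite: vertices colored white/black with each edge joining different colors. $\mathcal V_\circ(M)$ is the set of white vertices and $\mathrm{cc}(M)$ the number of connected components. Identify $\lambda$ with its Young diagram $\{(i,j):1\le j\le\lambda_i\}$ ($i$ row, $j$ column). A $\lambda$-injectively decorated map is a bipartite map with an injective function from its edges to the boxes of $\lambda$ such that edges incident to a common black vertex are sent to the same row and edges incident to a common white vertex are sent to the same column. A statistic of non-orientability is a nonnegative-integer-valued function $\vartheta$ on maps with $\vartheta(M)=0$ iff $M$ is orientable. -}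

module Defs where

open import Data.Nat using (ℕ; zero; suc; _≤ᵇ_; _≥_; _>_)
open import Data.Integer using (ℤ; +_; _-_)
open import Data.Fin using (Fin; toℕ; _≟_)
open import Data.Bool using (Bool; true; false; _∨_; _∧_; not; T)
open import Data.List using (List; []; _∷_; length; lookup; allFin; filterᵇ)
open import Data.Bool.ListAction using (any; all)
open import Data.Product using (Σ; _×_; proj₁; proj₂; _,_)
open import Relation.Binary.PropositionalEquality using (_≡_; _≢_)
open import Relation.Nullary.Decidable using (⌊_⌋)
open import Function using (_∘_)

data Decreasing : List ℕ → Set where
  []  : Decreasing []
  [_] : ∀ a → Decreasing (a ∷ [])
  _∷_ : ∀ {a b l} → a ≥ b → Decreasing (b ∷ l) → Decreasing (a ∷ b ∷ l)

data AllPos : List ℕ → Set where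
  []  : AllPos []
  _∷_ : ∀ {a l} → a > 0 → AllPos l → AllPos (a ∷ l)

record Partition : Set where
  field
    parts    : List ℕ
    positive : AllPos parts
    decr     : Decreasing parts

Box : Partition → Set
Box λp = Σ (Fin (length (Partition.parts λp)))
           (λ i → Fin (lookup (Partition.parts λp) i))

row : ∀ λp → Box λp → ℕ
row λp b = toℕ (proj₁ b)

col : ∀ λp → Box λp → ℕ
col λp b = toℕ (proj₂ b)

-- Maps, encoded combinatorially by their flags (Tutte / Lins encoding of
-- locally orientable maps): τ₀ changes the vertex, τ₁ the edge, τ₂ the
-- face of a flag.  Vertices = orbits of ⟨τ₁,τ₂⟩, edges = orbits of
-- ⟨τ₀,τ₂⟩, faces = orbits of ⟨τ₀,τ₁⟩, connected components = orbits of
-- ⟨τ₀,τ₁,τ₂⟩.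

record Map : Set where
  field
    nFlags : ℕ
    τ₀ τ₁ τ₂ : Fin nFlags → Fin nFlags
    inv₀ : ∀ f → τ₀ (τ₀ f) ≡ f
    inv₁ : ∀ f → τ₁ (τ₁ f) ≡ f
    inv₂ : ∀ f → τ₂ (τ₂ f) ≡ f
    fpf₀ : ∀ f → τ₀ f ≢ f
    fpf₁ : ∀ f → τ₁ f ≢ f
    fpf₂ : ∀ f → τ₂ f ≢ f
    comm₀₂ : ∀ f → τ₀ (τ₂ f) ≡ τ₂ (τ₀ f)
    fpf₀₂  : ∀ f → τ₀ (τ₂ f) ≢ f

module _ (M : Map) where
  open Map M

  Flag : Set
  Flag = Fin nFlags

  reach : List (Flag → Flag) → ℕ → Flag → Flag → Bool
  reach gens zero    f g = ⌊ f ≟ g ⌋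
  reach gens (suc k) f g = reach gens k f g ∨ any (λ s → reach gens k f (s g)) gens

  -- same orbit under the group generated by gens (words of length ≤ #flags suffice)
  sameOrbit : List (Flag → Flag) → Flag → Flag → Bool
  sameOrbit gens f g = reach gens nFlags f g

  isRep : List (Flag → Flag) → Flag → Bool
  isRep gens f = all (λ g → not (sameOrbit gens f g) ∨ (toℕ f ≤ᵇ toℕ g)) (allFin nFlags)

  countOrbits : List (Flag → Flag) → (Flag → Bool) → ℕ
  countOrbits gens P = length (filterᵇ (λ f → isRep gens f ∧ P f) (allFin nFlags))

  vertexGens edgeGens allGens : List (Flag → Flag)
  vertexGens = τ₁ ∷ τ₂ ∷ []
  edgeGens   = τ₀ ∷ τ₂ ∷ []
  allGens    = τ₀ ∷ τ₁ ∷ τ₂ ∷ []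

  SameVertex SameEdge : Flag → Flag → Set
  SameVertex f g = T (sameOrbit vertexGens f g)
  SameEdge   f g = T (sameOrbit edgeGens f g)

  cc : ℕ
  cc = countOrbits allGens (λ _ → true)

  -- orientable: every component is orientable, i.e. the flags admit a
  -- 2-colouring swapped by each of τ₀, τ₁, τ₂
  Orientable : Set
  Orientable = Σ (Flag → Bool) λ c →
    (∀ f → c (τ₀ f) ≢ c f) × (∀ f → c (τ₁ f) ≢ c f) × (∀ f → c (τ₂ f) ≢ c f)

IsNonOrientabilityStatistic : (Map → ℕ) → Set
IsNonOrientabilityStatistic ϑ = ∀ M → (ϑ M ≡ 0 → Orientable M) × (Orientable M → ϑ M ≡ 0)

record BipartiteMap : Set where
  field
    map : Map
  open Map map
  field
    white : Fin nFlags → Bool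
    white-τ₁ : ∀ f → white (τ₁ f) ≡ white f
    white-τ₂ : ∀ f → white (τ₂ f) ≡ white f
    white-τ₀ : ∀ f → white (τ₀ f) ≢ white f

numWhite : BipartiteMap → ℕ
numWhite B = countOrbits (BipartiteMap.map B) (vertexGens (BipartiteMap.map B)) (BipartiteMap.white B)

record InjDecoratedMap (λp : Partition) : Set where
  field
    bip : BipartiteMap
  open BipartiteMap bip
  open Map map
  field
    -- decoration of edges, given on flags and constant on each edge
    deco : Fin nFlags → Box λp
    deco-τ₀ : ∀ f → deco (τ₀ f) ≡ deco f
    deco-τ₂ : ∀ f → deco (τ₂ f) ≡ deco f
    deco-inj : ∀ f g → deco f ≡ deco g → SameEdge map f g
    black-row : ∀ f g → white f ≡ false → SameVertex map f g → row λp (deco f) ≡ row λp (deco g)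
    white-col : ∀ f g → white f ≡ true → SameVertex map f g → col λp (deco f) ≡ col λp (deco g)

underlying : ∀ {λp} → InjDecoratedMap λp → Map
underlying D = BipartiteMap.map (InjDecoratedMap.bip D)

numWhiteD : ∀ {λp} → InjDecoratedMap λp → ℕ
numWhiteD D = numWhite (InjDecoratedMap.bip D)

-- If |V∘(M)| = cc(M), every component contains exactly one white vertex: sending each
-- component to a white vertex inside it is injective, and would miss one of two distinct white
-- vertices of a common component.  All edges at a black vertex then share its row and the
-- column of that unique white vertex, so by injectivity of the decoration every black vertex
-- is a leaf.  A bipartite map whose black vertices are leaves is a union of stars, hence
-- orientable: the flags at a vertex split into two classes under the rotation τ₁τ₂, swapped by
-- τ₁ and τ₂, which orients the white vertices, and each black flag takes the colour opposite to
-- its τ₀-neighbour.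

module Submission where

open import Defs
open import Data.Nat.GeneralisedArithmetic using (fold; fold-+)
open import Data.Nat using (ℕ; zero; suc; _≤_; _<_; _≤′_; ≤′-refl; ≤′-step; _<ᵇ_; _≤ᵇ_)
open import Data.Nat.Properties
  using (≤⇒≤′; ≤ᵇ⇒≤; ≤⇒≤ᵇ; ≮⇒≥; <-irrefl; <⇒≤; ≤-antisym; +-comm; <ᵇ⇒<; <⇒<ᵇ; <⇒≯)
open import Data.Fin using (Fin; zero; suc; toℕ; fromℕ<; inject; _≟_)
open import Data.Fin.Properties
  using (toℕ-injective; injective⇒≤; ¬∀⟶∃¬-smallest; toℕ-inject; toℕ-fromℕ<)
open import Data.Integer using (+_; _-_)
open import Data.Integer.Properties using (+-injective; i-j≡0⇒i≡j)
open import Data.Bool using (Bool; true; false; _∨_; _∧_; not; T; if_then_else_)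
open import Data.Bool.Properties using (T?; T-∨; T-∧; T-not-≡; T-≡; not-¬; ¬-not; not-involutive)
open import Data.List using (List; []; _∷_; length; lookup; allFin; filterᵇ; _++_)
open import Data.List.Membership.Propositional using (_∈_; find)
open import Data.List.Membership.Propositional.Properties using (∈-filter⁺; ∈-filter⁻; ∈-lookup; ∈-allFin)
open import Data.List.Relation.Unary.All as All using (All; []; _∷_)
open import Data.List.Relation.Unary.All.Properties using (all⁺; all⁻; ¬Any⇒All¬)
open import Data.List.Relation.Unary.Any as Any using (here; there; index)
open import Data.List.Relation.Unary.Any.Properties using (any⁺; any⁻; lookup-index)
open import Data.List.Relation.Unary.AllPairs using ([]; _∷_)
open import Data.List.Relation.Unary.Unique.Propositional using (Unique)
open import Data.List.Relation.Unary.Unique.Propositional.Properties using (allFin⁺; filter⁺)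
open import Data.Product using (∃; ∃-syntax; _×_; _,_; proj₁; proj₂)
open import Data.Sum using (_⊎_; inj₁; inj₂)
open import Data.Unit using (tt)
open import Data.Empty using (⊥-elim)
open import Function using (_∘_; case_of_; Equivalence)
open import Relation.Nullary using (¬_; yes; no; contradiction)
open import Relation.Nullary.Decidable using (toWitness; fromWitness; decidable-stable; ¬?)
open import Relation.Binary.PropositionalEquality
  using (_≡_; _≢_; refl; sym; trans; cong; cong₂; subst; module ≡-Reasoning)

private
  variable
    A : Set

lookup-injective : {xs : List A} → Unique xs → ∀ i j → lookup xs i ≡ lookup xs j → i ≡ j
lookup-injective (_ ∷ _) zero zero _ = refl
lookup-injective (x∉ ∷ _) zero (suc j) e = contradiction e (All.lookup x∉ (∈-lookup j))
lookup-injective (x∉ ∷ _) (suc i) zero e = contradiction (sym e) (All.lookup x∉ (∈-lookup i))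
lookup-injective (_ ∷ u) (suc i) (suc j) e = cong suc (lookup-injective u i j e)

injective-into⇒≤-length : {k : ℕ} {ys : List A} (g : Fin k → A) →
  (∀ i → g i ∈ ys) → (∀ i j → g i ≡ g j → i ≡ j) → k ≤ length ys
injective-into⇒≤-length {ys = ys} g g∈ g-inj = injective⇒≤ λ {i} {j} e → g-inj i j (begin
  g i                           ≡⟨ lookup-index (g∈ i) ⟩
  lookup ys (index (g∈ i))      ≡⟨ cong (lookup ys) e ⟩
  lookup ys (index (g∈ j))      ≡⟨ lookup-index (g∈ j) ⟨
  g j                           ∎)
  where open ≡-Reasoning

Unique⇒length≤ : ∀ {n} {xs : List (Fin n)} → Unique xs → length xs ≤ n
Unique⇒length≤ u = injective⇒≤ (lookup-injective u _ _)

filterᵇ-length-< : ∀ {n} (P Q : Fin n → Bool) (h : Fin n → Fin n) →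
  (∀ {x} → T (Q x) → T (P (h x))) →
  (∀ {x y} → T (Q x) → T (Q y) → h x ≡ h y → x ≡ y) →
  ∀ {z} → T (P z) → (∀ {x} → T (Q x) → h x ≢ z) →
  length (filterᵇ Q (allFin n)) < length (filterᵇ P (allFin n))
filterᵇ-length-< {n} P Q h Q⇒P h-inj {z} Pz z∉img = injective-into⇒≤-length g g∈ g-inj
  where
  qs = filterᵇ Q (allFin n)

  Q-lookup : ∀ i → T (Q (lookup qs i))
  Q-lookup i = proj₂ (∈-filter⁻ (T? ∘ Q) {xs = allFin n} (∈-lookup i))

  g : Fin (suc (length qs)) → Fin n
  g zero    = z
  g (suc i) = h (lookup qs i)

  g∈ : ∀ i → g i ∈ filterᵇ P (allFin n)
  g∈ zero    = ∈-filter⁺ (T? ∘ P) (∈-allFin z) Pz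
  g∈ (suc i) = ∈-filter⁺ (T? ∘ P) (∈-allFin _) (Q⇒P (Q-lookup i))

  g-inj : ∀ i j → g i ≡ g j → i ≡ j
  g-inj zero    zero    _ = refl
  g-inj zero    (suc j) e = contradiction (sym e) (z∉img (Q-lookup j))
  g-inj (suc i) zero    e = contradiction e (z∉img (Q-lookup i))
  g-inj (suc i) (suc j) e = cong suc (lookup-injective (filter⁺ (T? ∘ Q) (allFin⁺ n)) i j
                              (h-inj (Q-lookup i) (Q-lookup j) e))

InverseClosed : List (A → A) → Set
InverseClosed gs = ∀ {s} → s ∈ gs → ∀ x → ∃[ s′ ] s′ ∈ gs × s′ (s x) ≡ x

involutions-inverseClosed : {gs : List (A → A)} →
  All (λ s → ∀ x → s (s x) ≡ x) gs → InverseClosed gs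
involutions-inverseClosed invs {s} s∈ x = s , s∈ , All.lookup invs s∈ x

module Orbits (M : Map) (gs : List (Flag M → Flag M)) (closed : InverseClosed gs) where
  open Map M using (nFlags)
  open import Data.List.Membership.DecPropositional (_≟_ {nFlags}) using (_∈?_)

  infix 4 _∼_
  _∼_ : Flag M → Flag M → Set
  f ∼ g = T (sameOrbit M gs f g)

  -- Walk f g vs: applying generators carries g to f, visiting the flags vs (f excluded).
  data Walk : Flag M → Flag M → List (Flag M) → Set where
    []  : ∀ {f} → Walk f f []
    _◅_ : ∀ {s f g vs} → s ∈ gs → Walk f (s g) vs → Walk f g (g ∷ vs)

  _◅◅_ : ∀ {f g h vs ws} → Walk f g vs → Walk g h ws → Walk f h (ws ++ vs)
  v ◅◅ []      = v
  v ◅◅ (s ◅ w) = s ◅ (v ◅◅ w)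

  reverse : ∀ {f g vs} → Walk f g vs → ∃ (Walk g f)
  reverse []                = _ , []
  reverse {g = g} (_◅_ {s} s∈ w) with closed s∈ g
  ... | s′ , s′∈ , s′sg≡g =
    _ , subst (λ x → Walk x (s g) _) s′sg≡g (s′∈ ◅ []) ◅◅ proj₂ (reverse w)

  walk⇒reach : ∀ {f g vs} → Walk f g vs → T (reach M gs (length vs) f g)
  walk⇒reach []                 = fromWitness refl
  walk⇒reach (s∈ ◅ w) =
    Equivalence.from T-∨ (inj₂ (any⁺ _ (Any.map (λ { refl → walk⇒reach w }) s∈)))

  reach⇒walk : ∀ k {f g} → T (reach M gs k f g) → ∃ (Walk f g)
  reach⇒walk zero    r with toWitness r
  ... | refl = _ , []
  reach⇒walk (suc k) r with Equivalence.to T-∨ r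
  ... | inj₁ r′ = reach⇒walk k r′
  ... | inj₂ r′ with find (any⁻ _ gs r′)
  ...   | s , s∈ , r″ = _ , s∈ ◅ proj₂ (reach⇒walk k r″)

  reach-mono : ∀ {k m f g} → k ≤′ m → T (reach M gs k f g) → T (reach M gs m f g)
  reach-mono ≤′-refl       r = r
  reach-mono (≤′-step k≤m) r = Equivalence.from T-∨ (inj₁ (reach-mono k≤m r))

  private
    suffix : ∀ {f g h vs} → Walk f g vs → h ∈ vs → Unique (f ∷ vs) →
             ∃[ us ] Walk f h us × Unique (f ∷ us)
    suffix w@(_ ◅ _) (here refl) u                       = _ , w , u
    suffix (_ ◅ w)   (there h∈)  ((_ ∷ f∉) ∷ (_ ∷ u)) = suffix w h∈ (f∉ ∷ u)

  simplify : ∀ {f g vs} → Walk f g vs → ∃[ ws ] Walk f g ws × Unique (f ∷ ws)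
  simplify []                = _ , [] , [] ∷ []
  simplify {f} {g} (s∈ ◅ w) with simplify w
  ... | ws , w′ , f∷ws-unique@(f∉ws ∷ ws-unique) with g ∈? f ∷ ws
  ...   | yes (here refl) = _ , [] , [] ∷ []
  ...   | yes (there g∈)  = suffix w′ g∈ f∷ws-unique
  ...   | no g∉           = _ , s∈ ◅ w′ , (g≢f ∷ f∉ws) ∷ ¬Any⇒All¬ ws (g∉ ∘ there) ∷ ws-unique
    where
    g≢f : f ≢ g
    g≢f f≡g = g∉ (here (sym f≡g))

  walk⇒∼ : ∀ {f g vs} → Walk f g vs → f ∼ g
  walk⇒∼ w with simplify w
  ... | ws , w′ , u = reach-mono (≤⇒≤′ (<⇒≤ (Unique⇒length≤ u))) (walk⇒reach w′)

  ∼⇒walk : ∀ {f g} → f ∼ g → ∃ (Walk f g)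
  ∼⇒walk = reach⇒walk nFlags

  ∼-refl : ∀ {f} → f ∼ f
  ∼-refl = walk⇒∼ []

  ∼-sym : ∀ {f g} → f ∼ g → g ∼ f
  ∼-sym = walk⇒∼ ∘ proj₂ ∘ reverse ∘ proj₂ ∘ ∼⇒walk

  ∼-trans : ∀ {f g h} → f ∼ g → g ∼ h → f ∼ h
  ∼-trans f∼g g∼h = walk⇒∼ (proj₂ (∼⇒walk f∼g) ◅◅ proj₂ (∼⇒walk g∼h))

  ∼-step : ∀ {s} → s ∈ gs → ∀ f → s f ∼ f
  ∼-step s∈ f = walk⇒∼ (s∈ ◅ [])

  ∼-invariant : (P : Flag M → Set) → All (λ s → ∀ {x} → P x → P (s x)) gs →
                ∀ {f g} → f ∼ g → P g → P f
  ∼-invariant P preserved = walk-invariant ∘ proj₂ ∘ ∼⇒walk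
    where
    walk-invariant : ∀ {f g vs} → Walk f g vs → P g → P f
    walk-invariant []       = λ Pg → Pg
    walk-invariant (s∈ ◅ w) = walk-invariant w ∘ All.lookup preserved s∈

  IsRep : Flag M → Set
  IsRep r = T (isRep M gs r)

  isRep-minimal : ∀ {r g} → IsRep r → r ∼ g → toℕ r ≤ toℕ g
  isRep-minimal {r} {g} rep r∼g with Equivalence.to T-∨ (All.lookup (all⁺ _ _ rep) (∈-allFin g))
  ... | inj₁ r≁g = ⊥-elim (subst T (Equivalence.to T-not-≡ r≁g) r∼g)
  ... | inj₂ r≤g = ≤ᵇ⇒≤ _ _ r≤g

  isRep-intro : ∀ {r} → (∀ g → r ∼ g → toℕ r ≤ toℕ g) → IsRep r
  isRep-intro {r} minimal = all⁻ _ {xs = allFin nFlags} (All.tabulate λ {g} _ → choose g)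
    where
    choose : ∀ g → T (not (sameOrbit M gs r g) ∨ (toℕ r ≤ᵇ toℕ g))
    choose g with sameOrbit M gs r g in r∼g
    ... | false = tt
    ... | true  = ≤⇒≤ᵇ (minimal g (subst T (sym r∼g) tt))

  isRep-unique : ∀ {r r′} → IsRep r → IsRep r′ → r ∼ r′ → r ≡ r′
  isRep-unique rep rep′ r∼r′ =
    toℕ-injective (≤-antisym (isRep-minimal rep r∼r′) (isRep-minimal rep′ (∼-sym r∼r′)))

  private
    least : ∀ f → ∃[ r ] f ∼ r × (∀ g → toℕ g < toℕ r → ¬ f ∼ g)
    least f with ¬∀⟶∃¬-smallest nFlags (λ g → ¬ f ∼ g) (λ g → ¬? (T? _)) (λ ∀≁ → ∀≁ f ∼-refl)
    ... | r , ¬¬f∼r , below = r , decidable-stable (T? _) ¬¬f∼r ,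
                              λ g g<r → subst (λ x → ¬ f ∼ x) (inject-fromℕ< g<r) (below (fromℕ< g<r))
      where
      inject-fromℕ< : ∀ {g} (g<r : toℕ g < toℕ r) → inject (fromℕ< g<r) ≡ g
      inject-fromℕ< g<r = toℕ-injective (trans (toℕ-inject (fromℕ< g<r)) (toℕ-fromℕ< g<r))

  rep : Flag M → Flag M
  rep f = proj₁ (least f)

  ∼-rep : ∀ f → f ∼ rep f
  ∼-rep f = proj₁ (proj₂ (least f))

  rep-isRep : ∀ f → IsRep (rep f)
  rep-isRep f = isRep-intro λ g r∼g →
    ≮⇒≥ λ g<r → proj₂ (proj₂ (least f)) g g<r (∼-trans (∼-rep f) r∼g)

  rep-cong : ∀ {f g} → f ∼ g → rep f ≡ rep g
  rep-cong {f} {g} f∼g = isRep-unique (rep-isRep f) (rep-isRep g)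
    (∼-trans (∼-sym (∼-rep f)) (∼-trans f∼g (∼-rep g)))

fold-suc : ∀ (x : A) (s : A → A) d → fold x s (suc d) ≡ fold (s x) s d
fold-suc x s d = trans (cong (fold x s) (+-comm 1 d)) (fold-+ x s d)

module _ {σ τ : A → A} (σ-inv : ∀ x → σ (σ x) ≡ x) (τ-inv : ∀ x → τ (τ x) ≡ x)
         (σ-fpf : ∀ x → σ x ≢ x) (τ-fpf : ∀ x → τ x ≢ x) where

  private
    σ-injective : ∀ {x y} → σ x ≡ σ y → x ≡ y
    σ-injective {x} {y} e = trans (sym (σ-inv x)) (trans (cong σ e) (σ-inv y))

  -- σ (στ x) = τ x turns σ x = (στ)^(d+2) x into σ y = (στ)^d y for y = στ x.
  σ∉⟨στ⟩-orbit : ∀ d x → σ x ≢ fold x (σ ∘ τ) d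
  σ∉⟨στ⟩-orbit zero          x e = σ-fpf x e
  σ∉⟨στ⟩-orbit (suc zero)    x e = τ-fpf x (sym (σ-injective e))
  σ∉⟨στ⟩-orbit (suc (suc d)) x e = σ∉⟨στ⟩-orbit d (σ (τ x)) (begin
    σ (σ (τ x))                      ≡⟨ σ-inv (τ x) ⟩
    τ x                              ≡⟨ cong τ (σ-injective e) ⟩
    τ (τ (fold x (σ ∘ τ) (suc d)))   ≡⟨ τ-inv _ ⟩
    fold x (σ ∘ τ) (suc d)           ≡⟨ fold-suc x (σ ∘ τ) d ⟩
    fold (σ (τ x)) (σ ∘ τ) d         ∎)
    where open ≡-Reasoning

<ᵇ-flip : ∀ {a b} → a ≢ b → (b <ᵇ a) ≡ not (a <ᵇ b)
<ᵇ-flip {a} {b} a≢b with a <ᵇ b in a<b | b <ᵇ a in b<a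
... | true  | true  =
  contradiction (<ᵇ⇒< b a (subst T (sym b<a) tt)) (<⇒≯ (<ᵇ⇒< a b (subst T (sym a<b) tt)))
... | true  | false = refl
... | false | true  = refl
... | false | false = contradiction (≤-antisym (≮⇒≥ (≮ b<a)) (≮⇒≥ (≮ a<b))) a≢b
  where
  ≮ : ∀ {m n} → (m <ᵇ n) ≡ false → ¬ m < n
  ≮ m≮n m<n = subst T m≮n (<⇒<ᵇ m<n)

module VertexOrientation (M : Map) where
  open Map M

  ρ ρ⁻¹ : Flag M → Flag M
  ρ   = τ₁ ∘ τ₂
  ρ⁻¹ = τ₂ ∘ τ₁

  ρ⁻¹∘ρ : ∀ x → ρ⁻¹ (ρ x) ≡ x
  ρ⁻¹∘ρ x = trans (cong τ₂ (inv₁ (τ₂ x))) (inv₂ x)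

  ρ∘ρ⁻¹ : ∀ x → ρ (ρ⁻¹ x) ≡ x
  ρ∘ρ⁻¹ x = trans (cong τ₁ (inv₂ (τ₁ x))) (inv₁ x)

  rotations : List (Flag M → Flag M)
  rotations = ρ ∷ ρ⁻¹ ∷ []

  rotations-inverseClosed : InverseClosed rotations
  rotations-inverseClosed (here refl)         x = ρ⁻¹ , there (here refl) , ρ⁻¹∘ρ x
  rotations-inverseClosed (there (here refl)) x = ρ , here refl , ρ∘ρ⁻¹ x

  open Orbits M rotations rotations-inverseClosed

  Rotated : Flag M → Flag M → Set
  Rotated f g = (∃[ d ] g ≡ fold f ρ d) ⊎ (∃[ d ] f ≡ fold g ρ d)

  Rotated-ρ : ∀ {f g} → Rotated f g → Rotated f (ρ g)
  Rotated-ρ (inj₁ (d , g≡))     = inj₁ (suc d , cong ρ g≡)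
  Rotated-ρ (inj₂ (zero , f≡g)) = inj₁ (1 , cong ρ (sym f≡g))
  Rotated-ρ {g = g} (inj₂ (suc d , f≡)) = inj₂ (d , trans f≡ (fold-suc g ρ d))

  Rotated-ρ⁻¹ : ∀ {f g} → Rotated f g → Rotated f (ρ⁻¹ g)
  Rotated-ρ⁻¹ {g = g} (inj₁ (zero , g≡f)) = inj₂ (1 , sym (trans (ρ∘ρ⁻¹ g) g≡f))
  Rotated-ρ⁻¹ (inj₁ (suc d , g≡))         = inj₁ (d , trans (cong ρ⁻¹ g≡) (ρ⁻¹∘ρ _))
  Rotated-ρ⁻¹ {g = g} (inj₂ (d , f≡))     =
    inj₂ (suc d , trans f≡ (trans (cong (λ y → fold y ρ d) (sym (ρ∘ρ⁻¹ g)))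
                                  (sym (fold-suc (ρ⁻¹ g) ρ d))))

  τ₁f≁f : ∀ f → ¬ τ₁ f ∼ f
  τ₁f≁f f τ₁f∼f
    with ∼-invariant (Rotated f) (Rotated-ρ ∷ Rotated-ρ⁻¹ ∷ []) τ₁f∼f (inj₁ (0 , refl))
  ... | inj₁ (d , e) = σ∉⟨στ⟩-orbit inv₁ inv₂ fpf₁ fpf₂ d f e
  ... | inj₂ (d , e) = σ∉⟨στ⟩-orbit inv₁ inv₂ fpf₁ fpf₂ d (τ₁ f) (trans (inv₁ f) e)

  infix 4 _<ʳ_
  _<ʳ_ : Flag M → Flag M → Bool
  f <ʳ g = toℕ (rep f) <ᵇ toℕ (rep g)

  <ʳ-cong : ∀ {f f′ g g′} → f ∼ f′ → g ∼ g′ → (f <ʳ g) ≡ (f′ <ʳ g′)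
  <ʳ-cong f∼f′ g∼g′ = cong₂ (λ x y → toℕ x <ᵇ toℕ y) (rep-cong f∼f′) (rep-cong g∼g′)

  -- The flags at a vertex split into two rotation classes, swapped by τ₁; orient picks one.
  orient : Flag M → Bool
  orient f = f <ʳ τ₁ f

  orient-τ₁ : ∀ f → orient (τ₁ f) ≡ not (orient f)
  orient-τ₁ f = begin
    τ₁ f <ʳ τ₁ (τ₁ f)   ≡⟨ cong (τ₁ f <ʳ_) (inv₁ f) ⟩
    τ₁ f <ʳ f           ≡⟨ <ᵇ-flip (reps-differ ∘ toℕ-injective) ⟩
    not (orient f)      ∎
    where
    open ≡-Reasoning
    reps-differ : rep f ≢ rep (τ₁ f)
    reps-differ e = τ₁f≁f f (∼-trans (∼-rep (τ₁ f)) (subst (_∼ f) e (∼-sym (∼-rep f))))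

  orient-τ₂ : ∀ f → orient (τ₂ f) ≡ not (orient f)
  orient-τ₂ f = begin
    τ₂ f <ʳ ρ f         ≡⟨ <ʳ-cong τ₂f∼τ₁f (∼-step (here refl) f) ⟩
    τ₁ f <ʳ f           ≡⟨ cong (τ₁ f <ʳ_) (inv₁ f) ⟨
    orient (τ₁ f)       ≡⟨ orient-τ₁ f ⟩
    not (orient f)      ∎
    where
    open ≡-Reasoning
    τ₂f∼τ₁f : τ₂ f ∼ τ₁ f
    τ₂f∼τ₁f = ∼-sym (subst (_∼ τ₂ f) (cong τ₁ (inv₂ f)) (∼-step (here refl) (τ₂ f)))

≡not⇒≢ : ∀ {x y} → x ≡ not y → x ≢ y
≡not⇒≢ x≡¬y x≡y = not-¬ refl (trans (sym x≡y) x≡¬y)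

module Bipartite (B : BipartiteMap) where
  open BipartiteMap B
  open Map map

  module V = Orbits map (vertexGens map) (involutions-inverseClosed (inv₁ ∷ inv₂ ∷ []))
  module A = Orbits map (allGens map) (involutions-inverseClosed (inv₀ ∷ inv₁ ∷ inv₂ ∷ []))
  module E = Orbits map (edgeGens map) (involutions-inverseClosed (inv₀ ∷ inv₂ ∷ []))

  white-τ₀-not : ∀ f → white (τ₀ f) ≡ not (white f)
  white-τ₀-not f = ¬-not (white-τ₀ f)

  white-vertex : ∀ {f g} → f V.∼ g → white f ≡ white g
  white-vertex {g = g} f∼g = V.∼-invariant (λ x → white x ≡ white g)
    ((λ e → trans (white-τ₁ _) e) ∷ (λ e → trans (white-τ₂ _) e) ∷ []) f∼g refl

  vertex⇒component : ∀ {f g} → f V.∼ g → f A.∼ g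
  vertex⇒component {g = g} f∼g = V.∼-invariant (A._∼ g) (All.tabulate (step ∘ there)) f∼g A.∼-refl
    where
    step : ∀ {s} → s ∈ allGens map → ∀ {x} → x A.∼ g → s x A.∼ g
    step s∈ x∼g = A.∼-trans (A.∼-step s∈ _) x∼g

  data EdgeFlag (f g : Flag map) : Set where
    itself    : g ≡ f → EdgeFlag f g
    τ₀-mate   : g ≡ τ₀ f → EdgeFlag f g
    τ₂-mate   : g ≡ τ₂ f → EdgeFlag f g
    τ₀τ₂-mate : g ≡ τ₀ (τ₂ f) → EdgeFlag f g

  EdgeFlag-τ₀ : ∀ {f g} → EdgeFlag f g → EdgeFlag f (τ₀ g)
  EdgeFlag-τ₀ (itself refl)    = τ₀-mate refl
  EdgeFlag-τ₀ (τ₀-mate refl)   = itself (inv₀ _)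
  EdgeFlag-τ₀ (τ₂-mate refl)   = τ₀τ₂-mate refl
  EdgeFlag-τ₀ (τ₀τ₂-mate refl) = τ₂-mate (inv₀ _)

  EdgeFlag-τ₂ : ∀ {f g} → EdgeFlag f g → EdgeFlag f (τ₂ g)
  EdgeFlag-τ₂ (itself refl)        = τ₂-mate refl
  EdgeFlag-τ₂ (τ₀-mate refl)       = τ₀τ₂-mate (sym (comm₀₂ _))
  EdgeFlag-τ₂ (τ₂-mate refl)       = itself (inv₂ _)
  EdgeFlag-τ₂ {f} (τ₀τ₂-mate refl) = τ₀-mate (trans (sym (comm₀₂ (τ₂ f))) (cong τ₀ (inv₂ f)))

  edge-EdgeFlag : ∀ {f g} → g E.∼ f → EdgeFlag f g
  edge-EdgeFlag g∼f = E.∼-invariant (EdgeFlag _) (EdgeFlag-τ₀ ∷ EdgeFlag-τ₂ ∷ []) g∼f (itself refl)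

  -- τ₁ keeps the colour, whereas τ₀ and τ₀ τ₂ change it
  τ₁-on-edge⇒τ₁≡τ₂ : ∀ {f} → τ₁ f E.∼ f → τ₁ f ≡ τ₂ f
  τ₁-on-edge⇒τ₁≡τ₂ {f} τ₁f∼f with edge-EdgeFlag τ₁f∼f
  ... | itself e    = contradiction e (fpf₁ f)
  ... | τ₀-mate e   = contradiction (trans (sym (cong white e)) (white-τ₁ f)) (≡not⇒≢ (white-τ₀-not f))
  ... | τ₂-mate e   = e
  ... | τ₀τ₂-mate e =
    contradiction (trans (sym (cong white e)) (trans (white-τ₁ f) (sym (white-τ₂ f))))
                  (≡not⇒≢ (white-τ₀-not (τ₂ f)))

  white-cases : ∀ {P : Set} f → (white f ≡ true → P) → (white f ≡ false → P) → P
  white-cases {P} f t b = split (white f) refl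
    where
    split : ∀ c → white f ≡ c → P
    split true  = t
    split false = b

  open VertexOrientation map using (orient; orient-τ₁; orient-τ₂)

  paint : Bool → Flag map → Bool
  paint true  f = orient f
  paint false f = not (orient (τ₀ f))

  colour : Flag map → Bool
  colour f = paint (white f) f

  colour-white : ∀ {f} → white f ≡ true → colour f ≡ orient f
  colour-white {f} w = cong (λ b → paint b f) w

  colour-black : ∀ {f} → white f ≡ false → colour f ≡ not (orient (τ₀ f))
  colour-black {f} w = cong (λ b → paint b f) w

  colour-τ₀ : ∀ f → colour (τ₀ f) ≡ not (colour f)
  colour-τ₀ f = white-cases f
    (λ w → begin
      colour (τ₀ f)              ≡⟨ colour-black (trans (white-τ₀-not f) (cong not w)) ⟩
      not (orient (τ₀ (τ₀ f)))   ≡⟨ cong (not ∘ orient) (inv₀ f) ⟩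
      not (orient f)             ≡⟨ cong not (colour-white w) ⟨
      not (colour f)             ∎)
    (λ w → begin
      colour (τ₀ f)              ≡⟨ colour-white (trans (white-τ₀-not f) (cong not w)) ⟩
      orient (τ₀ f)              ≡⟨ not-involutive _ ⟨
      not (not (orient (τ₀ f)))  ≡⟨ cong not (colour-black w) ⟨
      not (colour f)             ∎)
    where open ≡-Reasoning

  colour-τ₂ : ∀ f → colour (τ₂ f) ≡ not (colour f)
  colour-τ₂ f = white-cases f
    (λ w → begin
      colour (τ₂ f)              ≡⟨ colour-white (trans (white-τ₂ f) w) ⟩
      orient (τ₂ f)              ≡⟨ orient-τ₂ f ⟩
      not (orient f)             ≡⟨ cong not (colour-white w) ⟨
      not (colour f)             ∎)
    (λ w → begin
      colour (τ₂ f)              ≡⟨ colour-black (trans (white-τ₂ f) w) ⟩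
      not (orient (τ₀ (τ₂ f)))   ≡⟨ cong (not ∘ orient) (comm₀₂ f) ⟩
      not (orient (τ₂ (τ₀ f)))   ≡⟨ cong not (orient-τ₂ (τ₀ f)) ⟩
      not (not (orient (τ₀ f)))  ≡⟨ cong not (colour-black w) ⟨
      not (colour f)             ∎)
    where open ≡-Reasoning

  black-leaves⇒orientable : (∀ b → white b ≡ false → τ₁ b ≡ τ₂ b) → Orientable map
  black-leaves⇒orientable leaf =
    colour , ≡not⇒≢ ∘ colour-τ₀ , ≡not⇒≢ ∘ colour-τ₁ , ≡not⇒≢ ∘ colour-τ₂
    where
    colour-τ₁ : ∀ f → colour (τ₁ f) ≡ not (colour f)
    colour-τ₁ f = white-cases f
      (λ w → begin
        colour (τ₁ f)              ≡⟨ colour-white (trans (white-τ₁ f) w) ⟩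
        orient (τ₁ f)              ≡⟨ orient-τ₁ f ⟩
        not (orient f)             ≡⟨ cong not (colour-white w) ⟨
        not (colour f)             ∎)
      (λ w → trans (cong colour (leaf f w)) (colour-τ₂ f))
      where open ≡-Reasoning

  whiteEnd : Flag map → Flag map
  whiteEnd f = if white f then f else τ₀ f

  whiteEnd-white : ∀ f → white (whiteEnd f) ≡ true
  whiteEnd-white f with white f in w
  ... | true  = w
  ... | false = trans (white-τ₀-not f) (cong not w)

  whiteEnd-∼ : ∀ f → whiteEnd f A.∼ f
  whiteEnd-∼ f with white f
  ... | true  = A.∼-refl
  ... | false = A.∼-step (here refl) f

  whiteVertex : Flag map → Flag map
  whiteVertex f = V.rep (whiteEnd f)

  whiteVertex-∼ : ∀ f → whiteVertex f A.∼ f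
  whiteVertex-∼ f = A.∼-trans (vertex⇒component (V.∼-sym (V.∼-rep (whiteEnd f)))) (whiteEnd-∼ f)

  cc<numWhite : ∀ {w₁ w₂} → white w₁ ≡ true → white w₂ ≡ true → w₁ A.∼ w₂ → ¬ w₁ V.∼ w₂ →
                cc map < numWhite B
  cc<numWhite {w₁} {w₂} w₁-white w₂-white w₁∼w₂ w₁≁w₂ =
    case whiteVertex r₀ ≟ v₁ of λ where
      (yes h≡v₁) → missing v₂ (A.∼-trans (vertex⇒component (V.∼-sym (V.∼-rep w₂))) (A.∼-sym w₁∼w₂))
                     (white-vertex-rep w₂-white) (λ h≡v₂ → v₁≢v₂ (trans (sym h≡v₁) h≡v₂))
      (no h≢v₁)  → missing v₁ (vertex⇒component (V.∼-sym (V.∼-rep w₁)))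
                     (white-vertex-rep w₁-white) h≢v₁
    where
    r₀ v₁ v₂ : Flag map
    r₀ = A.rep w₁
    v₁ = V.rep w₁
    v₂ = V.rep w₂

    v₁≢v₂ : v₁ ≢ v₂
    v₁≢v₂ e = w₁≁w₂ (V.∼-trans (V.∼-rep w₁) (subst (V._∼ w₂) (sym e) (V.∼-sym (V.∼-rep w₂))))

    IsWhiteVertex IsComponent : Flag map → Bool
    IsWhiteVertex f = isRep map (vertexGens map) f ∧ white f
    IsComponent f   = isRep map (allGens map) f ∧ true

    white-vertex-rep : ∀ {w} → white w ≡ true → T (IsWhiteVertex (V.rep w))
    white-vertex-rep {w} w-white = Equivalence.from T-∧
      (V.rep-isRep w , Equivalence.from T-≡ (trans (white-vertex (V.∼-sym (V.∼-rep w))) w-white))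

    component-rep : ∀ {x} → T (IsComponent x) → A.IsRep x
    component-rep = proj₁ ∘ Equivalence.to T-∧

    missing : ∀ z → z A.∼ w₁ → T (IsWhiteVertex z) → whiteVertex r₀ ≢ z → cc map < numWhite B
    missing z z∼w₁ z-white h≢z = filterᵇ-length-< IsWhiteVertex IsComponent whiteVertex
      (λ {x} _ → white-vertex-rep (whiteEnd-white x))
      (λ qx qy e → A.isRep-unique (component-rep qx) (component-rep qy)
         (A.∼-trans (A.∼-sym (whiteVertex-∼ _)) (subst (A._∼ _) (sym e) (whiteVertex-∼ _))))
      z-white
      (λ {x} qx h≡z → h≢z (subst (λ y → whiteVertex y ≡ z) (x≡r₀ qx h≡z) h≡z))
      where
      x≡r₀ : ∀ {x} → T (IsComponent x) → whiteVertex x ≡ z → x ≡ r₀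
      x≡r₀ {x} qx h≡z = A.isRep-unique (component-rep qx) (A.rep-isRep w₁)
        (A.∼-trans (A.∼-sym (whiteVertex-∼ x))
                   (A.∼-trans (subst (A._∼ w₁) (sym h≡z) z∼w₁) (A.∼-rep w₁)))

box-≡ : ∀ {λp} {x y : Box λp} → row λp x ≡ row λp y → col λp x ≡ col λp y → x ≡ y
box-≡ {x = i , _} r c with toℕ-injective r
... | refl = cong (i ,_) (toℕ-injective c)

module InjDecorated {λp : Partition} (D : InjDecoratedMap λp) where
  open InjDecoratedMap D
  open BipartiteMap bip
  open Map map
  open Bipartite bip

  balanced⇒one-white-vertex : numWhite bip ≡ cc map → ∀ {w₁ w₂} →
    white w₁ ≡ true → white w₂ ≡ true → w₁ A.∼ w₂ → w₁ V.∼ w₂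
  balanced⇒one-white-vertex balanced w₁-white w₂-white w₁∼w₂ = decidable-stable (T? _)
    λ w₁≁w₂ → <-irrefl (sym balanced) (cc<numWhite w₁-white w₂-white w₁∼w₂ w₁≁w₂)

  balanced⇒black-leaves : numWhite bip ≡ cc map → ∀ b → white b ≡ false → τ₁ b ≡ τ₂ b
  balanced⇒black-leaves balanced b b-black = τ₁-on-edge⇒τ₁≡τ₂ (deco-inj (τ₁ b) b (sym same-box))
    where
    open ≡-Reasoning

    τ₀b-white : white (τ₀ b) ≡ true
    τ₀b-white = trans (white-τ₀-not b) (cong not b-black)

    τ₀τ₁b-white : white (τ₀ (τ₁ b)) ≡ true
    τ₀τ₁b-white = trans (white-τ₀-not (τ₁ b)) (cong not (trans (white-τ₁ b) b-black))

    same-component : τ₀ b A.∼ τ₀ (τ₁ b)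
    same-component = A.∼-trans (A.∼-step (here refl) b)
      (A.∼-trans (A.∼-sym (A.∼-step (there (here refl)) b)) (A.∼-sym (A.∼-step (here refl) (τ₁ b))))

    τ₀b∼τ₀τ₁b : τ₀ b V.∼ τ₀ (τ₁ b)
    τ₀b∼τ₀τ₁b = balanced⇒one-white-vertex balanced τ₀b-white τ₀τ₁b-white same-component

    same-col : col λp (deco b) ≡ col λp (deco (τ₁ b))
    same-col = begin
      col λp (deco b)              ≡⟨ cong (col λp) (deco-τ₀ b) ⟨
      col λp (deco (τ₀ b))         ≡⟨ white-col _ _ τ₀b-white τ₀b∼τ₀τ₁b ⟩
      col λp (deco (τ₀ (τ₁ b)))    ≡⟨ cong (col λp) (deco-τ₀ (τ₁ b)) ⟩
      col λp (deco (τ₁ b))         ∎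

    same-box : deco b ≡ deco (τ₁ b)
    same-box = box-≡ {λp} (black-row b (τ₁ b) b-black (V.∼-sym (V.∼-step (here refl) b))) same-col

lemma5p4 : (λp : Partition) (M : InjDecoratedMap λp) →
    (+ numWhiteD M) - (+ cc (underlying M)) ≡ + 0 →
    Orientable (underlying M) ×
      ((ϑ : Map → ℕ) → IsNonOrientabilityStatistic ϑ → ϑ (underlying M) ≡ 0)
lemma5p4 λp D difference≡0 =
  orientable , λ ϑ ϑ-statistic → proj₂ (ϑ-statistic (underlying D)) orientable
  where
  balanced : numWhiteD D ≡ cc (underlying D)
  balanced = +-injective (i-j≡0⇒i≡j _ _ difference≡0)

  orientable : Orientable (underlying D)
  orientable = Bipartite.black-leaves⇒orientable (InjDecoratedMap.bip D)
                 (InjDecorated.balanced⇒black-leaves D balanced)
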